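{- For every Boolean 4-tuple $t$ with exactly two ones and two zeros, $\mathcal{F}_{sep}$ is not a multimorphism of $\theta_t$.
   Context: For such $t$, $\theta_t:\{0,1\}^4\to\mathbb{R}$ is defined by $\theta_t(x)=-1$ if $x=(1,1,1,1)$ or $x=(0,0,0,0)$, $\theta_t(x)=1$ if $x=t$, and $\theta_t(x)=0$ otherwise. A map $\mathcal{F}=\langle f_1,\dots,f_k\rangle:D^k\to D^k$ is a multimorphism of an $n$-ary $\phi$ if $\sum_{i=1}^k\phi(t_i)\ge\sum_{i=1}^k\phi(f_i(t_1,\dots,t_k))$ for all $t_1,\dots,t_k\in D^n$, where $f_i$ acts coordinatewise: $f_i(t_1,\dots,t_k)=\langle f_i(t_1[1],\dots,t_k[1]),\dots,f_i(t_1[n],\dots,t_k[n])\rangle$. $\mathcal{F}_{sep}:\{0,1\}^5\to\{0,1\}^5$ is given by (bit strings): $00000\mapsto00000$, $00001\mapsto00001$, $00010\mapsto00001$, $00011\mapsto00011$, $00100\mapsto00001$, $00101\mapsto00011$, $00110\mapsto00101$, $00111\mapsto00111$, $01000\mapsto00010$, $01001\mapsto00011$, $01010\mapsto00011$, $01011\mapsto00111$, $01100\mapsto00011$, $01101\mapsto01011$, $01110\mapsto00111$, $01111\mapsto01111$, $10000\mapsto00010$, $10001\mapsto00011$, $10010\mapsto00011$, $10011\mapsto10011$, $10100\mapsto00011$, $10101\mapsto00111$, $10110\mapsto00111$, $10111\mapsto10111$, $11000\mapsto00110$, $11001\mapsto00111$, $11010\mapsto00111$, $11011\mapsto10111$,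 $11100\mapsto00111$, $11101\mapsto01111$, $11110\mapsto01111$, $11111\mapsto11111$; $f_i$ is the $i$-th output bit. -}

module Defs where

open import Data.Bool using (Bool; true; false)
open import Data.Nat using (ℕ)
open import Data.Integer using (ℤ; +_; -[1+_]; _+_; _≤_)
open import Data.Vec using (Vec; []; _∷_; map; transpose; foldr; countᵇ)
open import Data.Bool using (_∧_; _∨_; not; if_then_else_)
open import Function using (id)

sumℤ : ∀ {k : ℕ} → Vec ℤ k → ℤ
sumℤ = foldr _ _+_ (+ 0)

_==B_ : Bool → Bool → Bool
true  ==B true  = true
false ==B false = true
_     ==B _     = false

eqVec : ∀ {n : ℕ} → Vec Bool n → Vec Bool n → Bool
eqVec [] [] = true
eqVec (x ∷ xs) (y ∷ ys) = (x ==B y) ∧ eqVec xs ys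

-- θ_t(x) = -1 if x = 1111 or x = 0000, 1 if x = t, 0 otherwise
-- (for t with exactly two ones, these cases are disjoint)
θ : Vec Bool 4 → Vec Bool 4 → ℤ
θ t x =
  if eqVec x (true ∷ true ∷ true ∷ true ∷ []) ∨ eqVec x (false ∷ false ∷ false ∷ false ∷ [])
  then -[1+ 0 ]
  else (if eqVec x t then + 1 else + 0)

-- Coordinatewise application of F = ⟨f_1,…,f_k⟩ to k tuples t_1..t_k ∈ D^n:
-- row i of the result is f_i(t_1,…,t_k).
applyF : ∀ {k n : ℕ} → (Vec Bool k → Vec Bool k) → Vec (Vec Bool n) k → Vec (Vec Bool n) k
applyF F ts = transpose (map F (transpose ts))

IsMultimorphism : ∀ {k n : ℕ} → (Vec Bool k → Vec Bool k) → (Vec Bool n → ℤ) → Set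
IsMultimorphism F φ = ∀ ts → sumℤ (map φ (applyF F ts)) ≤ sumℤ (map φ ts)

-- bit string helper: b4 b3 b2 b1 b0 written left to right
pattern O = false
pattern I = true

Fsep : Vec Bool 5 → Vec Bool 5
Fsep (O ∷ O ∷ O ∷ O ∷ O ∷ []) = O ∷ O ∷ O ∷ O ∷ O ∷ []
Fsep (O ∷ O ∷ O ∷ O ∷ I ∷ []) = O ∷ O ∷ O ∷ O ∷ I ∷ []
Fsep (O ∷ O ∷ O ∷ I ∷ O ∷ []) = O ∷ O ∷ O ∷ O ∷ I ∷ []
Fsep (O ∷ O ∷ O ∷ I ∷ I ∷ []) = O ∷ O ∷ O ∷ I ∷ I ∷ []
Fsep (O ∷ O ∷ I ∷ O ∷ O ∷ []) = O ∷ O ∷ O ∷ O ∷ I ∷ []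
Fsep (O ∷ O ∷ I ∷ O ∷ I ∷ []) = O ∷ O ∷ O ∷ I ∷ I ∷ []
Fsep (O ∷ O ∷ I ∷ I ∷ O ∷ []) = O ∷ O ∷ I ∷ O ∷ I ∷ []
Fsep (O ∷ O ∷ I ∷ I ∷ I ∷ []) = O ∷ O ∷ I ∷ I ∷ I ∷ []
Fsep (O ∷ I ∷ O ∷ O ∷ O ∷ []) = O ∷ O ∷ O ∷ I ∷ O ∷ []
Fsep (O ∷ I ∷ O ∷ O ∷ I ∷ []) = O ∷ O ∷ O ∷ I ∷ I ∷ []
Fsep (O ∷ I ∷ O ∷ I ∷ O ∷ []) = O ∷ O ∷ O ∷ I ∷ I ∷ []
Fsep (O ∷ I ∷ O ∷ I ∷ I ∷ []) = O ∷ O ∷ I ∷ I ∷ I ∷ []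
Fsep (O ∷ I ∷ I ∷ O ∷ O ∷ []) = O ∷ O ∷ O ∷ I ∷ I ∷ []
Fsep (O ∷ I ∷ I ∷ O ∷ I ∷ []) = O ∷ I ∷ O ∷ I ∷ I ∷ []
Fsep (O ∷ I ∷ I ∷ I ∷ O ∷ []) = O ∷ O ∷ I ∷ I ∷ I ∷ []
Fsep (O ∷ I ∷ I ∷ I ∷ I ∷ []) = O ∷ I ∷ I ∷ I ∷ I ∷ []
Fsep (I ∷ O ∷ O ∷ O ∷ O ∷ []) = O ∷ O ∷ O ∷ I ∷ O ∷ []
Fsep (I ∷ O ∷ O ∷ O ∷ I ∷ []) = O ∷ O ∷ O ∷ I ∷ I ∷ []
Fsep (I ∷ O ∷ O ∷ I ∷ O ∷ []) = O ∷ O ∷ O ∷ I ∷ I ∷ []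
Fsep (I ∷ O ∷ O ∷ I ∷ I ∷ []) = I ∷ O ∷ O ∷ I ∷ I ∷ []
Fsep (I ∷ O ∷ I ∷ O ∷ O ∷ []) = O ∷ O ∷ O ∷ I ∷ I ∷ []
Fsep (I ∷ O ∷ I ∷ O ∷ I ∷ []) = O ∷ O ∷ I ∷ I ∷ I ∷ []
Fsep (I ∷ O ∷ I ∷ I ∷ O ∷ []) = O ∷ O ∷ I ∷ I ∷ I ∷ []
Fsep (I ∷ O ∷ I ∷ I ∷ I ∷ []) = I ∷ O ∷ I ∷ I ∷ I ∷ []
Fsep (I ∷ I ∷ O ∷ O ∷ O ∷ []) = O ∷ O ∷ I ∷ I ∷ O ∷ []
Fsep (I ∷ I ∷ O ∷ O ∷ I ∷ []) = O ∷ O ∷ I ∷ I ∷ I ∷ []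
Fsep (I ∷ I ∷ O ∷ I ∷ O ∷ []) = O ∷ O ∷ I ∷ I ∷ I ∷ []
Fsep (I ∷ I ∷ O ∷ I ∷ I ∷ []) = I ∷ O ∷ I ∷ I ∷ I ∷ []
Fsep (I ∷ I ∷ I ∷ O ∷ O ∷ []) = O ∷ O ∷ I ∷ I ∷ I ∷ []
Fsep (I ∷ I ∷ I ∷ O ∷ I ∷ []) = O ∷ I ∷ I ∷ I ∷ I ∷ []
Fsep (I ∷ I ∷ I ∷ I ∷ O ∷ []) = O ∷ I ∷ I ∷ I ∷ I ∷ []
Fsep (I ∷ I ∷ I ∷ I ∷ I ∷ []) = I ∷ I ∷ I ∷ I ∷ I ∷ []

module Submission where

-- For a balanced t (two ones, two zeros) a violation of θ_t is
-- built from the five OTHER balanced tuples of {0,1}⁴: none of them is t or a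
-- constant tuple, so their θ_t-values sum to 0.  Listed in a suitable order,
-- the four columns they form are sent by Fsep to columns whose five rows
-- contain t exactly once and no constant tuple, so the θ_t-values of the image
-- sum to 1 > 0.

open import Defs
open import Data.Bool using (Bool)
open import Data.Nat using (ℕ; s≤s; z≤n)
open import Data.Integer using (ℤ; +_; _<_; +<+)
open import Data.Integer.Properties using (<⇒≱)
open import Data.Product using (∃; _,_)
open import Data.Vec using (Vec; []; _∷_; map; countᵇ)
open import Function using (id)
open import Relation.Binary.PropositionalEquality using (_≡_; refl; sym; subst₂)
open import Relation.Nullary using (¬_)

Violation : ∀ {k n : ℕ} → (Vec Bool k → Vec Bool k) → (Vec Bool n → ℤ) → Set
Violation F φ = ∃ λ ts → sumℤ (map φ ts) < sumℤ (map φ (applyF F ts))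

violation⇒¬multimorphism : ∀ {k n : ℕ} {F : Vec Bool k → Vec Bool k}
  {φ : Vec Bool n → ℤ} → Violation F φ → ¬ IsMultimorphism F φ
violation⇒¬multimorphism (ts , increases) isMultimorphism =
  <⇒≱ increases (isMultimorphism ts)

violationFrom : ∀ {k n : ℕ} {F : Vec Bool k → Vec Bool k}
  {φ : Vec Bool n → ℤ} (ts : Vec (Vec Bool n) k) →
  sumℤ (map φ ts) ≡ + 0 → sumℤ (map φ (applyF F ts)) ≡ + 1 → Violation F φ
violationFrom ts before after =
  ts , subst₂ _<_ (sym before) (sym after) (+<+ (s≤s z≤n))

-- The family in each case lists the
-- five balanced tuples different from t; its third image row is t itself and
-- no image row is constant, which the two `refl`s confirm by evaluation.
balancedViolation : (t : Vec Bool 4) → countᵇ id t ≡ 2 → Violation Fsep (θ t)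
balancedViolation (O ∷ O ∷ I ∷ I ∷ []) _ = violationFrom
  ((O ∷ I ∷ O ∷ I ∷ []) ∷ (I ∷ O ∷ O ∷ I ∷ []) ∷ (I ∷ O ∷ I ∷ O ∷ []) ∷
   (O ∷ I ∷ I ∷ O ∷ []) ∷ (I ∷ I ∷ O ∷ O ∷ []) ∷ []) refl refl
balancedViolation (O ∷ I ∷ O ∷ I ∷ []) _ = violationFrom
  ((O ∷ O ∷ I ∷ I ∷ []) ∷ (I ∷ O ∷ O ∷ I ∷ []) ∷ (I ∷ I ∷ O ∷ O ∷ []) ∷
   (O ∷ I ∷ I ∷ O ∷ []) ∷ (I ∷ O ∷ I ∷ O ∷ []) ∷ []) refl refl
balancedViolation (O ∷ I ∷ I ∷ O ∷ []) _ = violationFrom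
  ((O ∷ O ∷ I ∷ I ∷ []) ∷ (I ∷ O ∷ I ∷ O ∷ []) ∷ (I ∷ I ∷ O ∷ O ∷ []) ∷
   (O ∷ I ∷ O ∷ I ∷ []) ∷ (I ∷ O ∷ O ∷ I ∷ []) ∷ []) refl refl
balancedViolation (I ∷ O ∷ O ∷ I ∷ []) _ = violationFrom
  ((O ∷ O ∷ I ∷ I ∷ []) ∷ (O ∷ I ∷ O ∷ I ∷ []) ∷ (I ∷ I ∷ O ∷ O ∷ []) ∷
   (I ∷ O ∷ I ∷ O ∷ []) ∷ (O ∷ I ∷ I ∷ O ∷ []) ∷ []) refl refl
balancedViolation (I ∷ O ∷ I ∷ O ∷ []) _ = violationFrom
  ((O ∷ O ∷ I ∷ I ∷ []) ∷ (O ∷ I ∷ I ∷ O ∷ []) ∷ (I ∷ I ∷ O ∷ O ∷ []) ∷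
   (I ∷ O ∷ O ∷ I ∷ []) ∷ (O ∷ I ∷ O ∷ I ∷ []) ∷ []) refl refl
balancedViolation (I ∷ I ∷ O ∷ O ∷ []) _ = violationFrom
  ((O ∷ I ∷ O ∷ I ∷ []) ∷ (O ∷ I ∷ I ∷ O ∷ []) ∷ (I ∷ O ∷ I ∷ O ∷ []) ∷
   (I ∷ O ∷ O ∷ I ∷ []) ∷ (O ∷ O ∷ I ∷ I ∷ []) ∷ []) refl refl
balancedViolation (O ∷ O ∷ O ∷ O ∷ []) ()
balancedViolation (O ∷ O ∷ O ∷ I ∷ []) ()
balancedViolation (O ∷ O ∷ I ∷ O ∷ []) ()
balancedViolation (O ∷ I ∷ O ∷ O ∷ []) ()
balancedViolation (O ∷ I ∷ I ∷ I ∷ []) ()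
balancedViolation (I ∷ O ∷ O ∷ O ∷ []) ()
balancedViolation (I ∷ O ∷ I ∷ I ∷ []) ()
balancedViolation (I ∷ I ∷ O ∷ I ∷ []) ()
balancedViolation (I ∷ I ∷ I ∷ O ∷ []) ()
balancedViolation (I ∷ I ∷ I ∷ I ∷ []) ()

proposition2 : (t : Vec Bool 4) → countᵇ id t ≡ 2 → ¬ IsMultimorphism Fsep (θ t)
proposition2 t balanced = violation⇒¬multimorphism (balancedViolation t balanced)
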